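{- For any graph $G$, every minimum sum set cover $\sigma$ of $H_G$ places all vertices of $B$ after all vertices of $A$, i.e., $\sigma(a)<\sigma(b)$ for all $a\in A$, $b\in B$.
   Context: Let $G$ be a finite simple graph with vertex set $A=V(G)=\{v_1,\dots,v_n\}$. The hypergraph $H_G$ has vertex set $A\cup B$ where $B=\{b_1,b_2,b_3\}$ is disjoint from $A$, and hyperedge set $\{X\cup\{b_k\}: k\in\{1,2,3\},\ X\subseteq A \text{ nonempty with } |X|\ne 2 \text{ or } X\in E(G)\}$. An ordering of a hypergraph $H$ is a bijection $\sigma:V(H)\to\{1,\dots,|V(H)|\}$; its cost is $\sum_{e\in E(H)}\min_{v\in e}\sigma(v)$. A minimum sum set cover of $H$ is an ordering of minimum cost. -}

module Defs where

open import Data.Bool using (Bool; true; false; not; _∧_; _∨_; if_then_else_)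
open import Data.Nat using (ℕ; zero; suc; _+_; _⊔_; _⊓_; _≤_; _<_; _≡ᵇ_)
open import Data.Fin using (Fin; toℕ)
open import Data.Fin.Subset using (Subset; ∣_∣)
open import Data.Vec using (Vec; []; _∷_; lookup)
open import Data.List using (List; []; _∷_; _++_; map; concatMap; filterᵇ; foldr; allFin)
open import Data.Nat.ListAction using (sum)
open import Data.Sum using (_⊎_; inj₁; inj₂)
open import Function.Bundles using (Bijection; _⤖_)
open import Relation.Binary.PropositionalEquality using (_≡_; _≢_)

record SimpleGraph (n : ℕ) : Set where
  field
    Adj   : Fin n → Fin n → Bool
    sym   : ∀ u v → Adj u v ≡ Adj v u
    irrefl : ∀ v → Adj v v ≡ false
open SimpleGraph public

-- Vertex set of H_G : A ⊎ B with A = Fin n and B = {b_1,b_2,b_3} = Fin 3.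
V : ℕ → Set
V n = Fin n ⊎ Fin 3

allV : (n : ℕ) → List (V n)
allV n = map inj₁ (allFin n) ++ map inj₂ (allFin 3)

allSubsets : (n : ℕ) → List (Subset n)
allSubsets zero = [] ∷ []
allSubsets (suc n) = map (true ∷_) (allSubsets n) ++ map (false ∷_) (allSubsets n)

-- X ∈ E(G): some adjacent pair u,v lies in X (used only when |X| = 2;
-- adjacent vertices are distinct by irreflexivity, so then X = {u,v}).
isGraphEdge : {n : ℕ} → SimpleGraph n → Subset n → Bool
isGraphEdge {n} G X =
  foldr _∨_ false (concatMap (λ u → map (λ v → lookup X u ∧ lookup X v ∧ Adj G u v) (allFin n)) (allFin n))

admissible : {n : ℕ} → SimpleGraph n → Subset n → Bool
admissible G X = not (∣ X ∣ ≡ᵇ 0) ∧ (not (∣ X ∣ ≡ᵇ 2) ∨ isGraphEdge G X)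

finEqᵇ : {m : ℕ} → Fin m → Fin m → Bool
finEqᵇ i j = toℕ i ≡ᵇ toℕ j

hyperedge : {n : ℕ} → Subset n → Fin 3 → V n → Bool
hyperedge X k (inj₁ i) = lookup X i
hyperedge X k (inj₂ j) = finEqᵇ j k

-- The hyperedge list of H_G (each hyperedge listed exactly once).
edgesH : {n : ℕ} → SimpleGraph n → List (V n → Bool)
edgesH {n} G = concatMap (λ k → map (λ X → hyperedge X k) (filterᵇ (admissible G) (allSubsets n))) (allFin 3)

-- An ordering of H_G: a bijection V(H_G) → {1,…,n+3}; we use Fin (n + 3)
-- and the position of v is 1 + toℕ (σ v) ∈ {1,…,n+3}.
Ordering : ℕ → Set
Ordering n = V n ⤖ Fin (n + 3)

pos : {n : ℕ} → Ordering n → V n → ℕ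
pos σ v = suc (toℕ (Bijection.to σ v))

-- min_{v ∈ e} σ(v); the start value n + 4 exceeds every position, and every
-- hyperedge is nonempty, so this is the true minimum.
minPos : {n : ℕ} → Ordering n → (V n → Bool) → ℕ
minPos {n} σ e = foldr (λ v acc → if e v then pos σ v ⊓ acc else acc) (n + 4) (allV n)

cost : {n : ℕ} → SimpleGraph n → Ordering n → ℕ
cost G σ = sum (map (minPos σ) (edgesH G))

IsMinSumSetCover : {n : ℕ} → SimpleGraph n → Ordering n → Set
IsMinSumSetCover {n} G σ = (τ : Ordering n) → cost G σ ≤ cost G τ

-- Measure time by the number t of positions already filled.  The hyperedge X ∪ {b} pays 1 at every
-- time at which b and all of X are still unplaced, so the cost of an ordering is Σₜ β(t) · F(j(t)),
-- where β(t) (unplacedB) is the number of unplaced vertices of B, j(t) (placed) the number of placed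
-- vertices of A, and F(j) (admissibleAbove) the number of admissible sets avoiding the first j
-- vertices of A in the order of σ.  Placing all of A first, in that order, costs 3 · S(0), where
-- S(j) = Σ_{l ≥ j} F(l) (tailSum).  The admissible sets that avoid the first j vertices and contain
-- the next one, u, include {u} and u ∪ Y for every set Y of at least two later vertices, and a
-- downward induction shows that there are at least S(j + 1) such Y; hence F(j) > S(j + 1).
-- Therefore the potential Φ(c, j) = c · F(j) + C(c, 2) · S(j + 1), with c ≤ 3 unplaced vertices of
-- B, drops by at most what σ pays in each step, and by strictly less when the first vertex of B is
-- placed while some vertex of A is not.  Telescoping gives cost σ > Φ(3, 0) = 3 · S(0).

module Submission where

open import Data.Bool using (Bool; true; false; T; not; _∧_; _∨_; if_then_else_)
open import Data.Bool.Properties using (T-∧)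
open import Data.Empty using (⊥-elim)
open import Data.Fin using (Fin; zero; suc; toℕ; fromℕ<; _↑ˡ_; _↑ʳ_; punchOut)
open import Data.Fin.Properties as Finₚ
  using (toℕ<n; toℕ-injective; toℕ-fromℕ<; toℕ-↑ˡ; toℕ-↑ʳ; punchOut-injective; injective⇒≤; any?)
open import Data.Fin.Subset using (Subset; ∣_∣; ⊥)
open import Data.Fin.Subset.Properties using (∣⊥∣≡0)
open import Data.List using (List; []; _∷_; _++_; map; concatMap; filterᵇ; foldr; allFin)
open import Data.List.Extrema.Nat using (argmin; f[argmin]≤f[xs])
open import Data.List.Membership.Propositional.Properties using (∈-allFin)
open import Data.List.Properties using (map-++; map-∘; map-cong)
open import Data.List.Relation.Unary.All as All using (All; []; _∷_)
open import Data.List.Relation.Unary.All.Properties using (++⁺; ++⁻; map⁺; map⁻)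
open import Data.Nat
  using (ℕ; zero; suc; _+_; _*_; _⊓_; _∸_; _≤_; _<_; _<ᵇ_; _≤ᵇ_; _≡ᵇ_; z≤n; s≤s; s≤s⁻¹)
open import Data.Nat.Combinatorics using (_C_; nC1≡n; nCk+nC[k+1]≡[n+1]C[k+1])
open import Data.Nat.ListAction using (sum)
open import Data.Nat.ListAction.Properties using (sum-++)
open import Data.Nat.Properties
open import Algebra.Properties.CommutativeSemigroup +-commutativeSemigroup using (interchange)
open import Data.Product using (_×_; _,_; proj₁; proj₂; ∃)
open import Data.Sum using (inj₁; inj₂)
open import Data.Sum.Properties using (inj₁-injective; inj₂-injective)
open import Data.Vec using ([]; _∷_; lookup; _[_]≔_)
open import Data.Vec.Properties using (lookup∘update′; lookup-replicate)
open import Function using (_∘_; case_of_)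
open import Function.Bundles using (Bijection; Equivalence; mk⤖)
open import Function.Consequences.Propositional using (strictlySurjective⇒surjective)
open import Function.Definitions using (Injective; StrictlySurjective)
open import Relation.Binary.Definitions using (tri<; tri≈; tri>)
open import Relation.Binary.PropositionalEquality
open import Relation.Nullary using (¬_; yes; no; contradiction)

open import Defs hiding (sym)

T-injective : ∀ {x y} → (T x → T y) → (T y → T x) → x ≡ y
T-injective {false} {false} _ _ = refl
T-injective {false} {true} _ y⇒x = ⊥-elim (y⇒x _)
T-injective {true} {false} x⇒y _ = ⊥-elim (x⇒y _)
T-injective {true} {true} _ _ = refl

-- x is explicit because it cannot be inferred from T (x ∧ y).
T-∧⁻ : ∀ x {y} → T (x ∧ y) → T x × T y
T-∧⁻ x = Equivalence.to (T-∧ {x})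

T-∧⁺ : ∀ x {y} → T x → T y → T (x ∧ y)
T-∧⁺ x tx ty = Equivalence.from (T-∧ {x}) (tx , ty)

T-not : ∀ {x} → ¬ T x → T (not x)
T-not {false} _ = _
T-not {true} ¬x = ¬x _

<ᵇ-suc : ∀ {x y} → x ≢ y → (x <ᵇ suc y) ≡ (x <ᵇ y)
<ᵇ-suc {x} x≢y = T-injective (λ h → <⇒<ᵇ (≤∧≢⇒< (s≤s⁻¹ (<ᵇ⇒< x _ h)) x≢y))
                             (λ h → <⇒<ᵇ (m<n⇒m<1+n (<ᵇ⇒< x _ h)))

indicator : Bool → ℕ
indicator true = 1
indicator false = 0

indicator-true : ∀ {x} → T x → indicator x ≡ 1
indicator-true {true} _ = refl

indicator-false : ∀ {x} → ¬ T x → indicator x ≡ 0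
indicator-false {false} _ = refl
indicator-false {true} ¬x = ⊥-elim (¬x _)

indicator-∧ : ∀ x y → indicator (x ∧ y) ≡ indicator x * indicator y
indicator-∧ true y = sym (+-identityʳ (indicator y))
indicator-∧ false y = refl

indicator-mono : ∀ {x y} → (T x → T y) → indicator x ≤ indicator y
indicator-mono {false} _ = z≤n
indicator-mono {true} {true} _ = ≤-refl
indicator-mono {true} {false} x⇒y = ⊥-elim (x⇒y _)

indicator-< : ∀ {x y} → ¬ T x → T y → indicator x < indicator y
indicator-< {false} {true} _ _ = s≤s z≤n
indicator-< {true} ¬x _ = ⊥-elim (¬x _)

count : ∀ n → (Fin n → Bool) → ℕ
count zero p = 0
count (suc n) p = indicator (p zero) + count n (p ∘ suc)

count-mono : ∀ {n} {p q : Fin n → Bool} → (∀ x → T (p x) → T (q x)) → count n p ≤ count n q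
count-mono {zero} _ = z≤n
count-mono {suc n} p⇒q = +-mono-≤ (indicator-mono (p⇒q zero)) (count-mono (p⇒q ∘ suc))

count-mono-< : ∀ {n} {p q : Fin n → Bool} → (∀ x → T (p x) → T (q x)) →
               ∀ x → ¬ T (p x) → T (q x) → count n p < count n q
count-mono-< {suc n} p⇒q zero ¬px qx = +-mono-<-≤ (indicator-< ¬px qx) (count-mono (p⇒q ∘ suc))
count-mono-< {suc n} p⇒q (suc x) ¬px qx =
  +-mono-≤-< (indicator-mono (p⇒q zero)) (count-mono-< (p⇒q ∘ suc) x ¬px qx)

count-cong : ∀ {n} {p q : Fin n → Bool} → (∀ x → p x ≡ q x) → count n p ≡ count n q
count-cong p≡q = ≤-antisym (count-mono (λ x → subst T (p≡q x))) (count-mono (λ x → subst T (sym (p≡q x))))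

count-none : ∀ {n} {p : Fin n → Bool} → (∀ x → ¬ T (p x)) → count n p ≡ 0
count-none {zero} _ = refl
count-none {suc n} {p} ¬p with p zero | ¬p zero
... | false | _ = count-none (¬p ∘ suc)
... | true | ¬p0 = ⊥-elim (¬p0 _)

count-all : ∀ {n} {p : Fin n → Bool} → (∀ x → T (p x)) → count n p ≡ n
count-all {zero} _ = refl
count-all {suc n} {p} all-p with p zero | all-p zero
... | true | _ = cong suc (count-all (all-p ∘ suc))

count≤n : ∀ {n} (p : Fin n → Bool) → count n p ≤ n
count≤n {n} p = subst (count n p ≤_) (count-all {p = λ _ → true} _) (count-mono {n} (λ _ _ → _))

count<n : ∀ {n} {p : Fin n → Bool} x → ¬ T (p x) → count n p < n
count<n {n} {p} x ¬px =
  subst (count n p <_) (count-all {p = λ _ → true} _) (count-mono-< {n} (λ _ _ → _) x ¬px _)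

count-update : ∀ {n} {p q : Fin n → Bool} x → T (p x) → ¬ T (q x) → (∀ y → y ≢ x → p y ≡ q y) →
               count n p ≡ suc (count n q)
count-update {suc n} {p} {q} zero px ¬qx same with p zero | q zero
... | true | false = cong suc (count-cong (λ y → same (suc y) λ ()))
... | false | _ = ⊥-elim px
... | _ | true = ⊥-elim (¬qx _)
count-update {suc n} {p} {q} (suc x) px ¬qx same =
  trans (cong₂ _+_ (cong indicator (same zero λ ()))
                   (count-update x px ¬qx (λ y y≢x → same (suc y) (y≢x ∘ Finₚ.suc-injective))))
        (+-suc _ _)

module _ {A : Set} where

  sum-map-mono : ∀ {f g : A → ℕ} → (∀ x → f x ≤ g x) → ∀ xs → sum (map f xs) ≤ sum (map g xs)
  sum-map-mono f≤g [] = z≤n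
  sum-map-mono f≤g (x ∷ xs) = +-mono-≤ (f≤g x) (sum-map-mono f≤g xs)

  sum-map-+ : ∀ (f g : A → ℕ) xs → sum (map (λ x → f x + g x) xs) ≡ sum (map f xs) + sum (map g xs)
  sum-map-+ f g [] = refl
  sum-map-+ f g (x ∷ xs) = trans (cong (f x + g x +_) (sum-map-+ f g xs)) (interchange (f x) (g x) _ _)

  sum-map-*ˡ : ∀ c (f : A → ℕ) xs → sum (map (λ x → c * f x) xs) ≡ c * sum (map f xs)
  sum-map-*ˡ c f [] = sym (*-zeroʳ c)
  sum-map-*ˡ c f (x ∷ xs) = trans (cong (c * f x +_) (sum-map-*ˡ c f xs)) (sym (*-distribˡ-+ c (f x) _))

  sum-map-*ʳ : ∀ c (f : A → ℕ) xs → sum (map (λ x → f x * c) xs) ≡ sum (map f xs) * c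
  sum-map-*ʳ c f [] = refl
  sum-map-*ʳ c f (x ∷ xs) = trans (cong (f x * c +_) (sum-map-*ʳ c f xs)) (sym (*-distribʳ-+ c (f x) _))

  sum-filterᵇ : ∀ (p q : A → Bool) xs →
                sum (map (indicator ∘ q) (filterᵇ p xs)) ≡ sum (map (λ x → indicator (p x ∧ q x)) xs)
  sum-filterᵇ p q [] = refl
  sum-filterᵇ p q (x ∷ xs) with p x
  ... | true = cong (indicator (q x) +_) (sum-filterᵇ p q xs)
  ... | false = sum-filterᵇ p q xs

  sum-concatMap : ∀ {B : Set} (f : B → ℕ) (g : A → List B) xs →
                  sum (map f (concatMap g xs)) ≡ sum (map (λ x → sum (map f (g x))) xs)
  sum-concatMap f g [] = refl
  sum-concatMap f g (x ∷ xs) = begin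
    sum (map f (g x ++ concatMap g xs))               ≡⟨ cong sum (map-++ f (g x) _) ⟩
    sum (map f (g x) ++ map f (concatMap g xs))       ≡⟨ sum-++ (map f (g x)) _ ⟩
    sum (map f (g x)) + sum (map f (concatMap g xs))  ≡⟨ cong (sum (map f (g x)) +_) (sum-concatMap f g xs) ⟩
    sum (map (λ x → sum (map f (g x))) (x ∷ xs))      ∎
    where open ≡-Reasoning

sumFrom : ℕ → ℕ → (ℕ → ℕ) → ℕ
sumFrom j zero f = 0
sumFrom j (suc m) f = f j + sumFrom (suc j) m f

sumFrom-cong : ∀ j m {f g : ℕ → ℕ} → (∀ t → f t ≡ g t) → sumFrom j m f ≡ sumFrom j m g
sumFrom-cong j zero f≡g = refl
sumFrom-cong j (suc m) f≡g = cong₂ _+_ (f≡g j) (sumFrom-cong (suc j) m f≡g)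

sumFrom-zero : ∀ j m → sumFrom j m (λ _ → 0) ≡ 0
sumFrom-zero j zero = refl
sumFrom-zero j (suc m) = sumFrom-zero (suc j) m

sumFrom-+ : ∀ j m (f g : ℕ → ℕ) → sumFrom j m (λ t → f t + g t) ≡ sumFrom j m f + sumFrom j m g
sumFrom-+ j zero f g = refl
sumFrom-+ j (suc m) f g =
  trans (cong (f j + g j +_) (sumFrom-+ (suc j) m f g)) (interchange (f j) (g j) _ _)

sumFrom-*ˡ : ∀ j m c (f : ℕ → ℕ) → sumFrom j m (λ t → c * f t) ≡ c * sumFrom j m f
sumFrom-*ˡ j zero c f = sym (*-zeroʳ c)
sumFrom-*ˡ j (suc m) c f =
  trans (cong (c * f j +_) (sumFrom-*ˡ (suc j) m c f)) (sym (*-distribˡ-+ c (f j) _))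

sum-map-sumFrom : ∀ {A : Set} j m (g : A → ℕ → ℕ) xs →
                  sum (map (λ x → sumFrom j m (g x)) xs) ≡ sumFrom j m (λ t → sum (map (λ x → g x t) xs))
sum-map-sumFrom j m g [] = sym (sumFrom-zero j m)
sum-map-sumFrom j m g (x ∷ xs) =
  trans (cong (sumFrom j m (g x) +_) (sum-map-sumFrom j m g xs)) (sym (sumFrom-+ j m (g x) _))

sumFrom-<ᵇ : ∀ j M m → sumFrom j M (λ t → indicator (t <ᵇ m)) ≡ (m ∸ j) ⊓ M
sumFrom-<ᵇ j zero m = sym (⊓-zeroʳ (m ∸ j))
sumFrom-<ᵇ j (suc M) m with j <? m
... | yes j<m = begin
  indicator (j <ᵇ m) + sumFrom (suc j) M (λ t → indicator (t <ᵇ m))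
    ≡⟨ cong₂ _+_ (indicator-true (<⇒<ᵇ j<m)) (sumFrom-<ᵇ (suc j) M m) ⟩
  suc ((m ∸ suc j) ⊓ M)   ≡⟨ cong (_⊓ suc M) (sym (+-∸-assoc 1 j<m)) ⟩
  (m ∸ j) ⊓ suc M         ∎
  where open ≡-Reasoning
... | no j≮m = begin
  indicator (j <ᵇ m) + sumFrom (suc j) M (λ t → indicator (t <ᵇ m))
    ≡⟨ cong₂ _+_ (indicator-false (j≮m ∘ <ᵇ⇒< j m)) (sumFrom-<ᵇ (suc j) M m) ⟩
  (m ∸ suc j) ⊓ M         ≡⟨ cong (_⊓ M) (m≤n⇒m∸n≡0 (m≤n⇒m≤1+n m≤j)) ⟩
  0                       ≡⟨ cong (_⊓ suc M) (sym (m≤n⇒m∸n≡0 m≤j)) ⟩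
  (m ∸ j) ⊓ suc M         ∎
  where open ≡-Reasoning
        m≤j = ≮⇒≥ j≮m

module _ {φ c : ℕ → ℕ} (descent : ∀ t → φ t ≤ c t + φ (suc t)) where

  private
    regroup : ∀ j m → c j + (sumFrom (suc j) m c + φ (suc j + m)) ≡ sumFrom j (suc m) c + φ (j + suc m)
    regroup j m = trans (sym (+-assoc (c j) _ _)) (cong (λ i → sumFrom j (suc m) c + φ i) (sym (+-suc j m)))

  telescope : ∀ j m → φ j ≤ sumFrom j m c + φ (j + m)
  telescope j zero = ≤-reflexive (cong φ (sym (+-identityʳ j)))
  telescope j (suc m) = begin
    φ j                                          ≤⟨ descent j ⟩
    c j + φ (suc j)                              ≤⟨ +-monoʳ-≤ (c j) (telescope (suc j) m) ⟩
    c j + (sumFrom (suc j) m c + φ (suc j + m))  ≡⟨ regroup j m ⟩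
    sumFrom j (suc m) c + φ (j + suc m)          ∎
    where open ≤-Reasoning

  telescope-< : ∀ {s} → φ s < c s + φ (suc s) → ∀ j m → j ≤ s → s < j + m → φ j < sumFrom j m c + φ (j + m)
  telescope-< _ j zero j≤s s<j+0 = contradiction (subst (_ <_) (+-identityʳ j) s<j+0) (≤⇒≯ j≤s)
  telescope-< {s} φs< j (suc m) j≤s s<j+m with j ≟ s
  ... | yes refl = begin-strict
    φ j                                          <⟨ φs< ⟩
    c j + φ (suc j)                              ≤⟨ +-monoʳ-≤ (c j) (telescope (suc j) m) ⟩
    c j + (sumFrom (suc j) m c + φ (suc j + m))  ≡⟨ regroup j m ⟩
    sumFrom j (suc m) c + φ (j + suc m)          ∎
    where open ≤-Reasoning
  ... | no j≢s = begin-strict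
    φ j                                          ≤⟨ descent j ⟩
    c j + φ (suc j)
      <⟨ +-monoʳ-< (c j) (telescope-< φs< (suc j) m (≤∧≢⇒< j≤s j≢s) (subst (s <_) (+-suc j m) s<j+m)) ⟩
    c j + (sumFrom (suc j) m c + φ (suc j + m))  ≡⟨ regroup j m ⟩
    sumFrom j (suc m) c + φ (j + suc m)          ∎
    where open ≤-Reasoning

countSubsets : ∀ n → (Subset n → Bool) → ℕ
countSubsets n P = sum (map (indicator ∘ P) (allSubsets n))

countSubsets-suc : ∀ n (P : Subset (suc n) → Bool) →
                   countSubsets (suc n) P ≡ countSubsets n (P ∘ (true ∷_)) + countSubsets n (P ∘ (false ∷_))
countSubsets-suc n P = begin
  sum (map (indicator ∘ P) (map (true ∷_) Xs ++ map (false ∷_) Xs))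
    ≡⟨ cong sum (map-++ (indicator ∘ P) (map (true ∷_) Xs) _) ⟩
  sum (map (indicator ∘ P) (map (true ∷_) Xs) ++ map (indicator ∘ P) (map (false ∷_) Xs))
    ≡⟨ sum-++ (map (indicator ∘ P) (map (true ∷_) Xs)) _ ⟩
  sum (map (indicator ∘ P) (map (true ∷_) Xs)) + sum (map (indicator ∘ P) (map (false ∷_) Xs))
    ≡⟨ sym (cong₂ _+_ (cong sum (map-∘ Xs)) (cong sum (map-∘ Xs))) ⟩
  countSubsets n (P ∘ (true ∷_)) + countSubsets n (P ∘ (false ∷_)) ∎
  where open ≡-Reasoning
        Xs = allSubsets n

countSubsets-mono : ∀ {n} {P Q : Subset n → Bool} → (∀ X → T (P X) → T (Q X)) →
                    countSubsets n P ≤ countSubsets n Q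
countSubsets-mono {n} P⇒Q = sum-map-mono (λ X → indicator-mono (P⇒Q X)) (allSubsets n)

countSubsets-none : ∀ n {P : Subset n → Bool} → (∀ X → ¬ T (P X)) → countSubsets n P ≡ 0
countSubsets-none zero ¬P = cong (_+ 0) (indicator-false (¬P []))
countSubsets-none (suc n) {P} ¬P = trans (countSubsets-suc n P)
  (cong₂ _+_ (countSubsets-none n (¬P ∘ (true ∷_))) (countSubsets-none n (¬P ∘ (false ∷_))))

countSubsets-witness : ∀ {n} {P : Subset n → Bool} X → T (P X) → 0 < countSubsets n P
countSubsets-witness {P = P} [] PX = subst (0 <_) (sym (cong (_+ 0) (indicator-true PX))) (s≤s z≤n)
countSubsets-witness {suc n} {P} (true ∷ X) PX rewrite countSubsets-suc n P =
  <-≤-trans (countSubsets-witness X PX) (m≤m+n _ _)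
countSubsets-witness {suc n} {P} (false ∷ X) PX rewrite countSubsets-suc n P =
  <-≤-trans (countSubsets-witness X PX) (m≤n+m _ _)

countSubsets-split : ∀ n (c P : Subset n → Bool) →
                     countSubsets n P ≡ countSubsets n (λ X → not (c X) ∧ P X) + countSubsets n (λ X → c X ∧ P X)
countSubsets-split n c P = trans (cong sum (map-cong split (allSubsets n))) (sum-map-+ _ _ (allSubsets n))
  where split : ∀ X → indicator (P X) ≡ indicator (not (c X) ∧ P X) + indicator (c X ∧ P X)
        split X with c X
        ... | true = refl
        ... | false = sym (+-identityʳ _)

countSubsets-insert : ∀ {n} (u : Fin n) (P : Subset n → Bool) →
                      countSubsets n (λ X → lookup X u ∧ P X) ≡
                      countSubsets n (λ Y → not (lookup Y u) ∧ P (Y [ u ]≔ true))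
countSubsets-insert {suc n} zero P
  rewrite countSubsets-suc n (λ X → lookup X zero ∧ P X)
        | countSubsets-suc n (λ Y → not (lookup Y zero) ∧ P (Y [ zero ]≔ true))
        | countSubsets-none n {λ _ → false} (λ _ ())
  = +-comm _ 0
countSubsets-insert {suc n} (suc u) P
  rewrite countSubsets-suc n (λ X → lookup X (suc u) ∧ P X)
        | countSubsets-suc n (λ Y → not (lookup Y (suc u)) ∧ P (Y [ suc u ]≔ true))
  = cong₂ _+_ (countSubsets-insert u (P ∘ (true ∷_))) (countSubsets-insert u (P ∘ (false ∷_)))

_⊆ᵇ_ : ∀ {n} → Subset n → (Fin n → Bool) → Bool
[] ⊆ᵇ W = true
(x ∷ X) ⊆ᵇ W = (not x ∨ W zero) ∧ (X ⊆ᵇ (W ∘ suc))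

⊆ᵇ⁺ : ∀ {n} {X : Subset n} {W} → (∀ a → T (lookup X a) → T (W a)) → T (X ⊆ᵇ W)
⊆ᵇ⁺ {X = []} _ = _
⊆ᵇ⁺ {X = false ∷ X} X⊆W = ⊆ᵇ⁺ {X = X} (X⊆W ∘ suc)
⊆ᵇ⁺ {X = true ∷ X} {W} X⊆W with W zero | X⊆W zero _
... | true | _ = ⊆ᵇ⁺ {X = X} (X⊆W ∘ suc)

⊆ᵇ⁻ : ∀ {n} {X : Subset n} {W} → T (X ⊆ᵇ W) → ∀ a → T (lookup X a) → T (W a)
⊆ᵇ⁻ {X = true ∷ X} {W} X⊆W zero _ = proj₁ (T-∧⁻ (W zero) X⊆W)
⊆ᵇ⁻ {X = x ∷ X} {W} X⊆W (suc a) = ⊆ᵇ⁻ {X = X} (proj₂ (T-∧⁻ (not x ∨ W zero) X⊆W)) a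

⊆ᵇ-mono : ∀ {n} {X : Subset n} {W W′} → (∀ a → T (W a) → T (W′ a)) → T (X ⊆ᵇ W) → T (X ⊆ᵇ W′)
⊆ᵇ-mono {X = X} W⊆W′ X⊆W = ⊆ᵇ⁺ {X = X} λ a a∈X → W⊆W′ a (⊆ᵇ⁻ {X = X} X⊆W a a∈X)

∣insert∣ : ∀ {n} (Y : Subset n) u → ¬ T (lookup Y u) → ∣ Y [ u ]≔ true ∣ ≡ suc ∣ Y ∣
∣insert∣ (false ∷ Y) zero _ = refl
∣insert∣ (true ∷ Y) zero u∉Y = ⊥-elim (u∉Y _)
∣insert∣ (false ∷ Y) (suc u) u∉Y = ∣insert∣ Y u u∉Y
∣insert∣ (true ∷ Y) (suc u) u∉Y = cong suc (∣insert∣ Y u u∉Y)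

∀∉⇒∣X∣≡0 : ∀ {n} (X : Subset n) → (∀ a → ¬ T (lookup X a)) → ∣ X ∣ ≡ 0
∀∉⇒∣X∣≡0 [] _ = refl
∀∉⇒∣X∣≡0 (false ∷ X) a∉X = ∀∉⇒∣X∣≡0 X (a∉X ∘ suc)
∀∉⇒∣X∣≡0 (true ∷ X) a∉X = ⊥-elim (a∉X zero _)

countSubsets-remove : ∀ {n} (P : Subset n → Bool) {W W′ : Fin n → Bool} {u} →
                      (∀ a → T (W′ a) → T (W a)) → T (W u) → ¬ T (W′ u) →
                      countSubsets n (λ X → P X ∧ X ⊆ᵇ W′) + countSubsets n (λ Y → P (Y [ u ]≔ true) ∧ Y ⊆ᵇ W′)
                        ≤ countSubsets n (λ X → P X ∧ X ⊆ᵇ W)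
countSubsets-remove {n} P {W} {W′} {u} W′⊆W u∈W u∉W′ = begin
  countSubsets n (λ X → P X ∧ X ⊆ᵇ W′) + countSubsets n (λ Y → P (Y [ u ]≔ true) ∧ Y ⊆ᵇ W′)
    ≤⟨ +-mono-≤ (countSubsets-mono without-u) (countSubsets-mono with-u) ⟩
  countSubsets n Without + countSubsets n (λ Y → not (lookup Y u) ∧ With (Y [ u ]≔ true))
    ≡⟨ cong (countSubsets n Without +_) (sym (countSubsets-insert u (λ X → P X ∧ X ⊆ᵇ W))) ⟩
  countSubsets n Without + countSubsets n (λ X → lookup X u ∧ With X)
    ≡⟨ sym (countSubsets-split n (λ X → lookup X u) With) ⟩
  countSubsets n With ∎
  where
  open ≤-Reasoning
  With Without : Subset n → Bool
  With X = P X ∧ X ⊆ᵇ W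
  Without X = not (lookup X u) ∧ With X
  u∉ : ∀ Y → T (Y ⊆ᵇ W′) → ¬ T (lookup Y u)
  u∉ Y Y⊆W′ u∈Y = u∉W′ (⊆ᵇ⁻ {X = Y} Y⊆W′ u u∈Y)
  without-u : ∀ X → T (P X ∧ X ⊆ᵇ W′) → T (Without X)
  without-u X h = let PX , X⊆W′ = T-∧⁻ (P X) h in
    T-∧⁺ (not (lookup X u)) (T-not (u∉ X X⊆W′)) (T-∧⁺ (P X) PX (⊆ᵇ-mono {X = X} W′⊆W X⊆W′))
  with-u : ∀ Y → T (P (Y [ u ]≔ true) ∧ Y ⊆ᵇ W′) → T (not (lookup Y u) ∧ With (Y [ u ]≔ true))
  with-u Y h =
    T-∧⁺ (not (lookup Y u)) (T-not (u∉ Y Y⊆W′)) (T-∧⁺ (P (Y [ u ]≔ true)) PY+u (⊆ᵇ⁺ {X = Y [ u ]≔ true} inserted))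
    where
    PY+u = proj₁ (T-∧⁻ (P (Y [ u ]≔ true)) h)
    Y⊆W′ = proj₂ (T-∧⁻ (P (Y [ u ]≔ true)) h)
    inserted : ∀ a → T (lookup (Y [ u ]≔ true) a) → T (W a)
    inserted a a∈Y+u with u Finₚ.≟ a
    ... | yes refl = u∈W
    ... | no u≢a = W′⊆W a (⊆ᵇ⁻ {X = Y} Y⊆W′ a (subst T (lookup∘update′ (u≢a ∘ sym) Y true) a∈Y+u))

largeIn : ∀ {n} → (Fin n → Bool) → ℕ
largeIn {n} W = countSubsets n (λ X → (2 ≤ᵇ ∣ X ∣) ∧ X ⊆ᵇ W)

module _ {n : ℕ} (G : SimpleGraph n) where

  admissible⇒nonempty : ∀ X → T (admissible G X) → 0 < ∣ X ∣
  admissible⇒nonempty X adm with ∣ X ∣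
  ... | suc _ = s≤s z≤n

  admissible-size : ∀ X → ∣ X ∣ ≢ 0 → ∣ X ∣ ≢ 2 → T (admissible G X)
  admissible-size X ≢0 ≢2 with ∣ X ∣
  ... | 0 = contradiction refl ≢0
  ... | 1 = _
  ... | 2 = contradiction refl ≢2
  ... | suc (suc (suc _)) = _

  admissibleIn : (Fin n → Bool) → ℕ
  admissibleIn W = countSubsets n (λ X → admissible G X ∧ X ⊆ᵇ W)

  admissibleIn-mono : ∀ {W W′ : Fin n → Bool} → (∀ a → T (W a) → T (W′ a)) → admissibleIn W ≤ admissibleIn W′
  admissibleIn-mono W⊆W′ = countSubsets-mono λ X h → let adm , X⊆W = T-∧⁻ (admissible G X) h in
    T-∧⁺ (admissible G X) adm (⊆ᵇ-mono {X = X} W⊆W′ X⊆W)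

  admissibleIn-empty : ∀ {W : Fin n → Bool} → (∀ a → ¬ T (W a)) → admissibleIn W ≡ 0
  admissibleIn-empty W≡∅ = countSubsets-none n λ X h → let adm , X⊆W = T-∧⁻ (admissible G X) h in
    <⇒≢ (admissible⇒nonempty X adm) (sym (∀∉⇒∣X∣≡0 X λ a a∈X → W≡∅ a (⊆ᵇ⁻ {X = X} X⊆W a a∈X)))

  module _ {W W′ : Fin n → Bool} {u : Fin n}
           (W′⊆W : ∀ a → T (W′ a) → T (W a)) (u∈W : T (W u)) (u∉W′ : ¬ T (W′ u)) where

    private
      u∉ : ∀ Y → T (Y ⊆ᵇ W′) → ¬ T (lookup Y u)
      u∉ Y Y⊆W′ u∈Y = u∉W′ (⊆ᵇ⁻ {X = Y} Y⊆W′ u u∈Y)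

      extendable : ∀ Y → T (Y ⊆ᵇ W′) → ∣ Y ∣ ≢ 1 → T (admissible G (Y [ u ]≔ true))
      extendable Y Y⊆W′ ∣Y∣≢1 = admissible-size (Y [ u ]≔ true)
        (λ ∣Y+u∣≡0 → 1+n≢0 (trans (sym size) ∣Y+u∣≡0))
        (λ ∣Y+u∣≡2 → ∣Y∣≢1 (suc-injective (trans (sym size) ∣Y+u∣≡2)))
        where size = ∣insert∣ Y u (u∉ Y Y⊆W′)

    admissibleIn-remove : admissibleIn W′ + suc (largeIn W′) ≤ admissibleIn W
    admissibleIn-remove = begin
      admissibleIn W′ + suc (largeIn W′)          ≤⟨ +-monoʳ-≤ (admissibleIn W′) extend ⟩
      admissibleIn W′ + countSubsets n Extendable  ≤⟨ countSubsets-remove (admissible G) W′⊆W u∈W u∉W′ ⟩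
      admissibleIn W                               ∎
      where
      open ≤-Reasoning
      Extendable : Subset n → Bool
      Extendable Y = admissible G (Y [ u ]≔ true) ∧ Y ⊆ᵇ W′
      large : ∀ Y → T ((2 ≤ᵇ ∣ Y ∣) ∧ Y ⊆ᵇ W′) → T (not (∣ Y ∣ ≡ᵇ 0) ∧ Extendable Y)
      large Y h = T-∧⁺ (not (∣ Y ∣ ≡ᵇ 0))
        (T-not λ ∣Y∣≡0 → contradiction (subst (2 ≤_) (≡ᵇ⇒≡ ∣ Y ∣ 0 ∣Y∣≡0) 2≤∣Y∣) λ ())
        (T-∧⁺ (admissible G (Y [ u ]≔ true))
          (extendable Y Y⊆W′ λ ∣Y∣≡1 → contradiction (subst (2 ≤_) ∣Y∣≡1 2≤∣Y∣) 1+n≰n) Y⊆W′)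
        where 2≤∣Y∣ = ≤ᵇ⇒≤ 2 ∣ Y ∣ (proj₁ (T-∧⁻ (2 ≤ᵇ ∣ Y ∣) h))
              Y⊆W′ = proj₂ (T-∧⁻ (2 ≤ᵇ ∣ Y ∣) h)
      empty : T ((∣ ⊥ {n} ∣ ≡ᵇ 0) ∧ Extendable ⊥)
      empty = T-∧⁺ (∣ ⊥ {n} ∣ ≡ᵇ 0) (subst (λ k → T (k ≡ᵇ 0)) (sym (∣⊥∣≡0 n)) _)
        (T-∧⁺ (admissible G (⊥ [ u ]≔ true))
          (extendable (⊥ {n}) ⊥⊆W′ λ ∣⊥∣≡1 → 0≢1+n (trans (sym (∣⊥∣≡0 n)) ∣⊥∣≡1)) ⊥⊆W′)
        where ⊥⊆W′ : T (⊥ {n} ⊆ᵇ W′)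
              ⊥⊆W′ = ⊆ᵇ⁺ {X = ⊥ {n}} λ a a∈⊥ → ⊥-elim (subst T (lookup-replicate a false) a∈⊥)
      extend : suc (largeIn W′) ≤ countSubsets n Extendable
      extend = begin
        suc (largeIn W′)   ≡⟨ +-comm 1 _ ⟩
        largeIn W′ + 1     ≤⟨ +-mono-≤ (countSubsets-mono large) (countSubsets-witness (⊥ {n}) empty) ⟩
        countSubsets n (λ Y → not (∣ Y ∣ ≡ᵇ 0) ∧ Extendable Y) + countSubsets n (λ Y → (∣ Y ∣ ≡ᵇ 0) ∧ Extendable Y)
                           ≡⟨ sym (countSubsets-split n (λ Y → ∣ Y ∣ ≡ᵇ 0) Extendable) ⟩
        countSubsets n Extendable ∎

    largeIn-remove : largeIn W′ + admissibleIn W′ ≤ largeIn W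
    largeIn-remove = begin
      largeIn W′ + admissibleIn W′
        ≤⟨ +-monoʳ-≤ (largeIn W′) (countSubsets-mono grow) ⟩
      largeIn W′ + countSubsets n (λ Y → (2 ≤ᵇ ∣ Y [ u ]≔ true ∣) ∧ Y ⊆ᵇ W′)
        ≤⟨ countSubsets-remove (λ X → 2 ≤ᵇ ∣ X ∣) W′⊆W u∈W u∉W′ ⟩
      largeIn W ∎
      where
      open ≤-Reasoning
      grow : ∀ Y → T (admissible G Y ∧ Y ⊆ᵇ W′) → T ((2 ≤ᵇ ∣ Y [ u ]≔ true ∣) ∧ Y ⊆ᵇ W′)
      grow Y h = let adm , Y⊆W′ = T-∧⁻ (admissible G Y) h in
        T-∧⁺ (2 ≤ᵇ ∣ Y [ u ]≔ true ∣)
          (≤⇒≤ᵇ (subst (2 ≤_) (sym (∣insert∣ Y u (u∉ Y Y⊆W′))) (s≤s (admissible⇒nonempty Y adm)))) Y⊆W′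

-- The cost as a sum over time

module _ {A : Set} (h : A → ℕ) (e : A → Bool) {t : ℕ} where

  <-foldr-⊓⁻ : ∀ z vs → t < foldr (λ v acc → if e v then h v ⊓ acc else acc) z vs →
               All (λ v → T (e v) → t < h v) vs
  <-foldr-⊓⁻ z [] _ = []
  <-foldr-⊓⁻ z (v ∷ vs) t<min with e v in ev≡
  ... | true = (λ _ → m<n⊓o⇒m<n (h v) _ t<min) ∷ <-foldr-⊓⁻ z vs (m<n⊓o⇒m<o (h v) _ t<min)
  ... | false = (λ ev → ⊥-elim (subst T ev≡ ev)) ∷ <-foldr-⊓⁻ z vs t<min

  <-foldr-⊓⁺ : ∀ z vs → All (λ v → T (e v) → t < h v) vs → t < z →
               t < foldr (λ v acc → if e v then h v ⊓ acc else acc) z vs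
  <-foldr-⊓⁺ z [] [] t<z = t<z
  <-foldr-⊓⁺ z (v ∷ vs) (t<hv ∷ t<hvs) t<z with e v
  ... | true = ⊓-pres-m< (t<hv _) (<-foldr-⊓⁺ z vs t<hvs t<z)
  ... | false = <-foldr-⊓⁺ z vs t<hvs t<z

module Layers {n : ℕ} (ω : Ordering n) where

  unplaced : ℕ → V n → Bool
  unplaced t v = t <ᵇ pos ω v

  unplacedB : ℕ → ℕ
  unplacedB t = count 3 (λ k → unplaced t (inj₂ k))

  pos≤ : ∀ v → pos ω v ≤ n + 3
  pos≤ v = toℕ<n (Bijection.to ω v)

  module _ {t : ℕ} (X : Subset n) (k : Fin 3) where

    <-minPos⁻ : t < minPos ω (hyperedge X k) →
                (∀ a → T (lookup X a) → t < pos ω (inj₁ a)) × t < pos ω (inj₂ k)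
    <-minPos⁻ t<min with ++⁻ (map inj₁ (allFin n)) (<-foldr-⊓⁻ (pos ω) (hyperedge X k) (n + 4) (allV n) t<min)
    ... | on-A , on-B = (λ a → All.lookup (map⁻ {f = inj₁} on-A) (∈-allFin a)) ,
                        All.lookup (map⁻ {xs = allFin 3} {f = inj₂} on-B) (∈-allFin k) (≡⇒≡ᵇ (toℕ k) (toℕ k) refl)

    <-minPos⁺ : (∀ a → T (lookup X a) → t < pos ω (inj₁ a)) → t < pos ω (inj₂ k) →
                t < minPos ω (hyperedge X k)
    <-minPos⁺ t<A t<b = <-foldr-⊓⁺ (pos ω) (hyperedge X k) (n + 4) (allV n)
      (++⁺ (map⁺ {xs = allFin n} {f = inj₁} (All.tabulate λ {a} _ → t<A a))
           (map⁺ {f = inj₂} (All.tabulate λ {j} _ j≡k →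
             subst (λ j → t < pos ω (inj₂ j)) (sym (toℕ-injective (≡ᵇ⇒≡ (toℕ j) (toℕ k) j≡k))) t<b)))
      (<-≤-trans t<b (≤-trans (pos≤ (inj₂ k)) (+-monoʳ-≤ n (n≤1+n 3))))

    minPos-unplaced : (t <ᵇ minPos ω (hyperedge X k)) ≡ unplaced t (inj₂ k) ∧ X ⊆ᵇ (λ a → unplaced t (inj₁ a))
    minPos-unplaced = T-injective
      (λ h → let t<A , t<b = <-minPos⁻ (<ᵇ⇒< t _ h) in
        T-∧⁺ (unplaced t (inj₂ k)) (<⇒<ᵇ t<b) (⊆ᵇ⁺ {X = X} λ a a∈X → <⇒<ᵇ (t<A a a∈X)))
      (λ h → let t<b , X⊆unplaced = T-∧⁻ (unplaced t (inj₂ k)) h in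
        <⇒<ᵇ (<-minPos⁺ (λ a a∈X → <ᵇ⇒< t _ (⊆ᵇ⁻ {X = X} X⊆unplaced a a∈X)) (<ᵇ⇒< t _ t<b)))

  minPos≤ : ∀ X k → minPos ω (hyperedge X k) ≤ n + 3
  minPos≤ X k = ≤-trans (≮⇒≥ λ b<min → <-irrefl refl (proj₂ (<-minPos⁻ X k b<min))) (pos≤ (inj₂ k))

  minPos-layers : ∀ X k → minPos ω (hyperedge X k) ≡
                  sumFrom 0 (n + 3) (λ t → indicator (unplaced t (inj₂ k)) * indicator (X ⊆ᵇ λ a → unplaced t (inj₁ a)))
  minPos-layers X k = begin
    minPos ω (hyperedge X k)                                              ≡⟨ sym (m≤n⇒m⊓n≡m (minPos≤ X k)) ⟩
    minPos ω (hyperedge X k) ⊓ (n + 3)                                    ≡⟨ sym (sumFrom-<ᵇ 0 (n + 3) _) ⟩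
    sumFrom 0 (n + 3) (λ t → indicator (t <ᵇ minPos ω (hyperedge X k)))
      ≡⟨ sumFrom-cong 0 (n + 3) (λ t → trans (cong indicator (minPos-unplaced {t} X k))
                                             (indicator-∧ (unplaced t (inj₂ k)) _)) ⟩
    sumFrom 0 (n + 3) (λ t → indicator (unplaced t (inj₂ k)) * indicator (X ⊆ᵇ λ a → unplaced t (inj₁ a))) ∎
    where open ≡-Reasoning

  cost-layers : ∀ G → cost G ω ≡ sumFrom 0 (n + 3) (λ t → unplacedB t * admissibleIn G (λ a → unplaced t (inj₁ a)))
  cost-layers G = begin
    sum (map (minPos ω) (concatMap (λ k → map (λ X → hyperedge X k) L) (allFin 3)))
      ≡⟨ sum-concatMap (minPos ω) (λ k → map (λ X → hyperedge X k) L) (allFin 3) ⟩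
    sum (map (λ k → sum (map (minPos ω) (map (λ X → hyperedge X k) L))) (allFin 3))
      ≡⟨ cong sum (map-cong (λ k → cong sum (trans (sym (map-∘ {g = minPos ω} {f = λ X → hyperedge X k} L))
                                                   (map-cong (λ X → minPos-layers X k) L)))
                            (allFin 3)) ⟩
    sum (map (λ k → sum (map (λ X → sumFrom 0 (n + 3) (term k X)) L)) (allFin 3))
      ≡⟨ cong sum (map-cong (λ k → sum-map-sumFrom 0 (n + 3) (term k) L) (allFin 3)) ⟩
    sum (map (λ k → sumFrom 0 (n + 3) (λ t → sum (map (λ X → term k X t) L))) (allFin 3))
      ≡⟨ sum-map-sumFrom 0 (n + 3) (λ k t → sum (map (λ X → term k X t) L)) (allFin 3) ⟩
    sumFrom 0 (n + 3) (λ t → sum (map (λ k → sum (map (λ X → term k X t) L)) (allFin 3)))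
      ≡⟨ sumFrom-cong 0 (n + 3) layer ⟩
    sumFrom 0 (n + 3) (λ t → unplacedB t * admissibleIn G (λ a → unplaced t (inj₁ a))) ∎
    where
    open ≡-Reasoning
    L = filterᵇ (admissible G) (allSubsets n)
    term : Fin 3 → Subset n → ℕ → ℕ
    term k X t = indicator (unplaced t (inj₂ k)) * indicator (X ⊆ᵇ λ a → unplaced t (inj₁ a))
    layer : ∀ t → sum (map (λ k → sum (map (λ X → term k X t) L)) (allFin 3)) ≡
                  unplacedB t * admissibleIn G (λ a → unplaced t (inj₁ a))
    layer t = trans
      (cong sum (map-cong (λ k → trans (sum-map-*ˡ (indicator (unplaced t (inj₂ k)))
                                                   (λ X → indicator (X ⊆ᵇ λ a → unplaced t (inj₁ a))) L)
                                       (cong (indicator (unplaced t (inj₂ k)) *_)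
                                             (sum-filterᵇ (admissible G) _ (allSubsets n))))
                          (allFin 3)))
      (sum-map-*ʳ (admissibleIn G (λ a → unplaced t (inj₁ a))) (λ k → indicator (unplaced t (inj₂ k))) (allFin 3))

-- Admissible sets above a rank

module Ranked {n : ℕ} (G : SimpleGraph n) (rank : Fin n → ℕ)
              (rank<n : ∀ a → rank a < n) (rank-onto : ∀ {l} → l < n → ∃ λ u → rank u ≡ l) where

  above : ℕ → Fin n → Bool
  above l a = l ≤ᵇ rank a

  admissibleAbove : ℕ → ℕ
  admissibleAbove l = admissibleIn G (above l)

  largeAbove : ℕ → ℕ
  largeAbove l = largeIn (above l)

  tailSum : ℕ → ℕ
  tailSum j = sumFrom j (n ∸ j) admissibleAbove

  admissibleAbove-vanishes : ∀ {l} → n ≤ l → admissibleAbove l ≡ 0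
  admissibleAbove-vanishes {l} n≤l =
    admissibleIn-empty G λ a l≤rank → <⇒≱ (rank<n a) (≤-trans n≤l (≤ᵇ⇒≤ l (rank a) l≤rank))

  tailSum-vanishes : ∀ {j} → n ≤ j → tailSum j ≡ 0
  tailSum-vanishes n≤j rewrite m≤n⇒m∸n≡0 n≤j = refl

  tailSum-step : ∀ j → tailSum j ≡ admissibleAbove j + tailSum (suc j)
  tailSum-step j with j <? n
  ... | yes j<n = cong (λ m → sumFrom j m admissibleAbove) (+-∸-assoc 1 j<n)
  ... | no j≮n = trans (tailSum-vanishes n≤j)
                       (sym (cong₂ _+_ (admissibleAbove-vanishes n≤j) (tailSum-vanishes (m≤n⇒m≤1+n n≤j))))
    where n≤j = ≮⇒≥ j≮n

  sumFrom-admissibleAbove : ∀ j m → n ≤ j + m → sumFrom j m admissibleAbove ≡ tailSum j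
  sumFrom-admissibleAbove j zero n≤j+0 = sym (tailSum-vanishes (subst (n ≤_) (+-identityʳ j) n≤j+0))
  sumFrom-admissibleAbove j (suc m) n≤j+m =
    trans (cong (admissibleAbove j +_) (sumFrom-admissibleAbove (suc j) m (subst (n ≤_) (+-suc j m) n≤j+m)))
          (sym (tailSum-step j))

  module _ {l : ℕ} (l<n : l < n) where

    private
      u = proj₁ (rank-onto l<n)
      rank-u = proj₂ (rank-onto l<n)

      above-suc⊆ : ∀ a → T (above (suc l) a) → T (above l a)
      above-suc⊆ a h = ≤⇒≤ᵇ (≤-trans (n≤1+n l) (≤ᵇ⇒≤ (suc l) (rank a) h))

      u-above : T (above l u)
      u-above = ≤⇒≤ᵇ (≤-reflexive (sym rank-u))

      u-not-above : ¬ T (above (suc l) u)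
      u-not-above h = 1+n≰n (subst (suc l ≤_) rank-u (≤ᵇ⇒≤ (suc l) (rank u) h))

    admissibleAbove-step : admissibleAbove (suc l) + suc (largeAbove (suc l)) ≤ admissibleAbove l
    admissibleAbove-step = admissibleIn-remove G above-suc⊆ u-above u-not-above

    largeAbove-step : largeAbove (suc l) + admissibleAbove (suc l) ≤ largeAbove l
    largeAbove-step = largeIn-remove G above-suc⊆ u-above u-not-above

  sumFrom≤largeAbove : ∀ m l → l + m < n → sumFrom (suc l) m admissibleAbove ≤ largeAbove l
  sumFrom≤largeAbove zero l _ = z≤n
  sumFrom≤largeAbove (suc m) l l+m<n = begin
    admissibleAbove (suc l) + sumFrom (suc (suc l)) m admissibleAbove
      ≤⟨ +-monoʳ-≤ (admissibleAbove (suc l)) (sumFrom≤largeAbove m (suc l) (subst (_< n) (+-suc l m) l+m<n)) ⟩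
    admissibleAbove (suc l) + largeAbove (suc l)  ≡⟨ +-comm (admissibleAbove (suc l)) _ ⟩
    largeAbove (suc l) + admissibleAbove (suc l)  ≤⟨ largeAbove-step (≤-<-trans (m≤m+n l (suc m)) l+m<n) ⟩
    largeAbove l                                  ∎
    where open ≤-Reasoning

  tailSum≤largeAbove : ∀ l → tailSum (suc l) ≤ largeAbove l
  tailSum≤largeAbove l with l <? n
  ... | yes l<n = sumFrom≤largeAbove (n ∸ suc l) l (≤-reflexive (m+[n∸m]≡n l<n))
  ... | no l≮n = subst (_≤ largeAbove l) (sym (tailSum-vanishes (m≤n⇒m≤1+n (≮⇒≥ l≮n)))) z≤n

  tailSum<admissibleAbove : ∀ {j} → j < n → tailSum (suc j) < admissibleAbove j
  tailSum<admissibleAbove {j} j<n = begin-strict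
    tailSum (suc j)                                     ≡⟨ tailSum-step (suc j) ⟩
    admissibleAbove (suc j) + tailSum (suc (suc j))     ≤⟨ +-monoʳ-≤ (admissibleAbove (suc j)) (tailSum≤largeAbove (suc j)) ⟩
    admissibleAbove (suc j) + largeAbove (suc j)        <⟨ +-monoʳ-< (admissibleAbove (suc j)) ≤-refl ⟩
    admissibleAbove (suc j) + suc (largeAbove (suc j))  ≤⟨ admissibleAbove-step j<n ⟩
    admissibleAbove j                                   ∎
    where open ≤-Reasoning

  tailSum≤admissibleAbove : ∀ j → tailSum (suc j) ≤ admissibleAbove j
  tailSum≤admissibleAbove j with j <? n
  ... | yes j<n = <⇒≤ (tailSum<admissibleAbove j<n)
  ... | no j≮n = subst (_≤ admissibleAbove j) (sym (tailSum-vanishes (m≤n⇒m≤1+n (≮⇒≥ j≮n)))) z≤n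

  potential : ℕ → ℕ → ℕ
  potential c j = c * admissibleAbove j + (c C 2) * tailSum (suc j)

  potential-placeA : ∀ {c} j → c ≤ 3 → potential c j ≤ c * admissibleAbove j + potential c (suc j)
  potential-placeA {c} j c≤3 = begin
    c * F j + (c C 2) * tailSum (suc j)
      ≡⟨ cong (λ x → c * F j + (c C 2) * x) (tailSum-step (suc j)) ⟩
    c * F j + (c C 2) * (F (suc j) + tailSum (suc (suc j)))
      ≡⟨ cong (c * F j +_) (*-distribˡ-+ (c C 2) (F (suc j)) _) ⟩
    c * F j + ((c C 2) * F (suc j) + (c C 2) * tailSum (suc (suc j)))
      ≤⟨ +-monoʳ-≤ (c * F j) (+-monoˡ-≤ _ (*-monoˡ-≤ (F (suc j)) (C2≤ c≤3))) ⟩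
    c * F j + (c * F (suc j) + (c C 2) * tailSum (suc (suc j)))  ∎
    where
    open ≤-Reasoning
    F = admissibleAbove
    C2≤ : ∀ {c} → c ≤ 3 → c C 2 ≤ c
    C2≤ {0} _ = z≤n
    C2≤ {1} _ = z≤n
    C2≤ {2} _ = s≤s z≤n
    C2≤ {3} _ = ≤-refl
    C2≤ {suc (suc (suc (suc _)))} (s≤s (s≤s (s≤s ())))

  private
    potential-suc : ∀ c j → potential (suc c) j ≡
                            suc c * admissibleAbove j + (c * tailSum (suc j) + (c C 2) * tailSum (suc j))
    potential-suc c j = trans (cong (λ x → suc c * admissibleAbove j + x * tailSum (suc j)) (sym pascal))
                              (cong (suc c * admissibleAbove j +_) (*-distribʳ-+ (tailSum (suc j)) c (c C 2)))
      where pascal : c + c C 2 ≡ suc c C 2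
            pascal = trans (cong (_+ c C 2) (sym (nC1≡n c))) (nCk+nC[k+1]≡[n+1]C[k+1] c 1)

  potential-placeB : ∀ c j → potential (suc c) j ≤ suc c * admissibleAbove j + potential c j
  potential-placeB c j = begin
    potential (suc c) j
      ≡⟨ potential-suc c j ⟩
    suc c * admissibleAbove j + (c * tailSum (suc j) + (c C 2) * tailSum (suc j))
      ≤⟨ +-monoʳ-≤ (suc c * admissibleAbove j) (+-monoˡ-≤ _ (*-monoʳ-≤ c (tailSum≤admissibleAbove j))) ⟩
    suc c * admissibleAbove j + potential c j ∎
    where open ≤-Reasoning

  potential-placeB-< : ∀ c {j} → j < n →
                       potential (suc (suc c)) j < suc (suc c) * admissibleAbove j + potential (suc c) j
  potential-placeB-< c {j} j<n = begin-strict
    potential (suc (suc c)) j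
      ≡⟨ potential-suc (suc c) j ⟩
    suc (suc c) * admissibleAbove j + (suc c * tailSum (suc j) + (suc c C 2) * tailSum (suc j))
      <⟨ +-monoʳ-< (suc (suc c) * admissibleAbove j) (+-monoˡ-< _ (*-monoʳ-< (suc c) (tailSum<admissibleAbove j<n))) ⟩
    suc (suc c) * admissibleAbove j + potential (suc c) j ∎
    where open ≤-Reasoning

  potential-start : potential 3 0 ≡ 3 * tailSum 0
  potential-start = trans (sym (*-distribˡ-+ 3 (admissibleAbove 0) (tailSum 1))) (cong (3 *_) (sym (tailSum-step 0)))

injective⇒strictlySurjective : ∀ {m} (f : Fin m → Fin m) → Injective _≡_ _≡_ f → StrictlySurjective _≡_ f
injective⇒strictlySurjective {suc m} f f-injective y with any? (λ x → f x Finₚ.≟ y)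
... | yes hit = hit
... | no miss = contradiction (injective⇒≤ punched-injective) 1+n≰n
  where
  y≢f : ∀ x → y ≢ f x
  y≢f x y≡fx = miss (x , sym y≡fx)
  punched-injective : Injective _≡_ _≡_ (λ x → punchOut (y≢f x))
  punched-injective eq = f-injective (punchOut-injective (y≢f _) (y≢f _) eq)

-- Comparison with the ordering that places A first

module Rearrangement {n : ℕ} (G : SimpleGraph n) (σ : Ordering n) where

  open Layers σ using (unplaced; unplacedB; cost-layers)

  ρ : V n → ℕ
  ρ v = toℕ (Bijection.to σ v)

  ρ-injective : ∀ {v w} → ρ v ≡ ρ w → v ≡ w
  ρ-injective eq = Bijection.injective σ (toℕ-injective eq)

  σ⁻¹ : Fin (n + 3) → V n
  σ⁻¹ y = proj₁ (Bijection.strictlySurjective σ y)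

  σ∘σ⁻¹ : ∀ y → Bijection.to σ (σ⁻¹ y) ≡ y
  σ∘σ⁻¹ y = proj₂ (Bijection.strictlySurjective σ y)

  ρ-onto : ∀ {t} → t < n + 3 → ∃ λ v → ρ v ≡ t
  ρ-onto t<N = σ⁻¹ (fromℕ< t<N) , trans (cong toℕ (σ∘σ⁻¹ (fromℕ< t<N))) (toℕ-fromℕ< t<N)

  unplaced⁺ : ∀ {t v} → t ≤ ρ v → T (unplaced t v)
  unplaced⁺ t≤ρv = <⇒<ᵇ (s≤s t≤ρv)

  unplaced⁻ : ∀ {t v} → T (unplaced t v) → t ≤ ρ v
  unplaced⁻ {t} h = s≤s⁻¹ (<ᵇ⇒< t _ h)

  placed : ℕ → ℕ
  placed t = count n (λ a → ρ (inj₁ a) <ᵇ t)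

  rank : Fin n → ℕ
  rank a = placed (ρ (inj₁ a))

  placed-mono : ∀ {t t′} → t ≤ t′ → placed t ≤ placed t′
  placed-mono t≤t′ = count-mono {n} λ a h → <⇒<ᵇ (<-≤-trans (<ᵇ⇒< (ρ (inj₁ a)) _ h) t≤t′)

  rank<placed : ∀ {a t} → ρ (inj₁ a) < t → rank a < placed t
  rank<placed {a} ρa<t = count-mono-< {n} (λ a′ h → <⇒<ᵇ (<-trans (<ᵇ⇒< (ρ (inj₁ a′)) _ h) ρa<t))
                                       a (<-irrefl refl ∘ <ᵇ⇒< (ρ (inj₁ a)) _) (<⇒<ᵇ ρa<t)

  rank<n : ∀ a → rank a < n
  rank<n a = count<n {n} {λ a′ → ρ (inj₁ a′) <ᵇ ρ (inj₁ a)} a (<-irrefl refl ∘ <ᵇ⇒< (ρ (inj₁ a)) _)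

  rank-injective : ∀ {a a′} → rank a ≡ rank a′ → a ≡ a′
  rank-injective {a} {a′} eq with <-cmp (ρ (inj₁ a)) (ρ (inj₁ a′))
  ... | tri< lt _ _ = contradiction eq (<⇒≢ (rank<placed lt))
  ... | tri≈ _ ρ≡ _ = inj₁-injective (ρ-injective ρ≡)
  ... | tri> _ _ gt = contradiction (sym eq) (<⇒≢ (rank<placed gt))

  τ-to : V n → Fin (n + 3)
  τ-to (inj₁ a) = fromℕ< (rank<n a) ↑ˡ 3
  τ-to (inj₂ k) = n ↑ʳ k

  toℕ-τ-A : ∀ a → toℕ (τ-to (inj₁ a)) ≡ rank a
  toℕ-τ-A a = trans (toℕ-↑ˡ (fromℕ< (rank<n a)) 3) (toℕ-fromℕ< (rank<n a))

  toℕ-τ-B : ∀ k → toℕ (τ-to (inj₂ k)) ≡ n + toℕ k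
  toℕ-τ-B k = toℕ-↑ʳ n k

  private
    n+≢rank : ∀ (k : Fin 3) a → n + toℕ k ≢ rank a
    n+≢rank k a eq = <⇒≱ (rank<n a) (subst (n ≤_) eq (m≤m+n n (toℕ k)))

  τ-injective : Injective _≡_ _≡_ τ-to
  τ-injective {inj₁ a} {inj₁ a′} eq =
    cong inj₁ (rank-injective (trans (sym (toℕ-τ-A a)) (trans (cong toℕ eq) (toℕ-τ-A a′))))
  τ-injective {inj₁ a} {inj₂ k} eq =
    contradiction (trans (sym (toℕ-τ-B k)) (trans (cong toℕ (sym eq)) (toℕ-τ-A a))) (n+≢rank k a)
  τ-injective {inj₂ k} {inj₁ a} eq =
    contradiction (trans (sym (toℕ-τ-B k)) (trans (cong toℕ eq) (toℕ-τ-A a))) (n+≢rank k a)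
  τ-injective {inj₂ k} {inj₂ k′} eq =
    cong inj₂ (toℕ-injective (+-cancelˡ-≡ n _ _ (trans (sym (toℕ-τ-B k)) (trans (cong toℕ eq) (toℕ-τ-B k′)))))

  τ-onto : StrictlySurjective _≡_ τ-to
  τ-onto y = let x , τσ⁻¹x≡y = injective⇒strictlySurjective (τ-to ∘ σ⁻¹) τσ⁻¹-injective y in σ⁻¹ x , τσ⁻¹x≡y
    where τσ⁻¹-injective : Injective _≡_ _≡_ (τ-to ∘ σ⁻¹)
          τσ⁻¹-injective {x} {x′} eq =
            trans (sym (σ∘σ⁻¹ x)) (trans (cong (Bijection.to σ) (τ-injective eq)) (σ∘σ⁻¹ x′))

  τ : Ordering n
  τ = mk⤖ (τ-injective , strictlySurjective⇒surjective τ-onto)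

  rank-onto : ∀ {l} → l < n → ∃ λ u → rank u ≡ l
  rank-onto {l} l<n with τ-onto (fromℕ< (m≤n⇒m≤n+o 3 l<n))
  ... | v , τv≡l with v | trans (cong toℕ τv≡l) (toℕ-fromℕ< (m≤n⇒m≤n+o 3 l<n))
  ...   | inj₁ u | τu≡l = u , trans (sym (toℕ-τ-A u)) τu≡l
  ...   | inj₂ k | τk≡l = contradiction (trans (sym (toℕ-τ-B k)) τk≡l)
                                        (λ n+k≡l → <⇒≱ l<n (subst (n ≤_) n+k≡l (m≤m+n n (toℕ k))))

  open Ranked G rank rank<n rank-onto

  admissible-unplaced : ∀ t → admissibleIn G (λ a → unplaced t (inj₁ a)) ≡ admissibleAbove (placed t)
  admissible-unplaced t = ≤-antisym
    (admissibleIn-mono G λ a h → ≤⇒≤ᵇ (placed-mono (unplaced⁻ {t} {inj₁ a} h)))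
    (admissibleIn-mono G λ a h → unplaced⁺ {t} {inj₁ a}
      (≮⇒≥ λ ρa<t → <⇒≱ (rank<placed ρa<t) (≤ᵇ⇒≤ (placed t) (rank a) h)))

  private
    other-placed : ∀ {v t} → ρ v ≡ t → ∀ a → inj₁ a ≢ v → (ρ (inj₁ a) <ᵇ suc t) ≡ (ρ (inj₁ a) <ᵇ t)
    other-placed ρv≡t a a≢v = <ᵇ-suc λ ρa≡t → a≢v (ρ-injective (trans ρa≡t (sym ρv≡t)))

    other-unplaced : ∀ {v t} → ρ v ≡ t → ∀ k → inj₂ k ≢ v → unplaced t (inj₂ k) ≡ unplaced (suc t) (inj₂ k)
    other-unplaced ρv≡t k k≢v = <ᵇ-suc λ t≡ρk → k≢v (ρ-injective (trans (sym t≡ρk) (sym ρv≡t)))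

  placeA : ∀ {a t} → ρ (inj₁ a) ≡ t → placed (suc t) ≡ suc (placed t) × unplacedB (suc t) ≡ unplacedB t
  placeA {a} {t} ρa≡t =
    count-update a (<⇒<ᵇ (s≤s (≤-reflexive ρa≡t))) (λ h → <-irrefl ρa≡t (<ᵇ⇒< (ρ (inj₁ a)) t h))
                 (λ a′ a′≢a → other-placed ρa≡t a′ (a′≢a ∘ inj₁-injective)) ,
    count-cong λ k → sym (other-unplaced ρa≡t k λ ())

  placeB : ∀ {b t} → ρ (inj₂ b) ≡ t → placed (suc t) ≡ placed t × unplacedB t ≡ suc (unplacedB (suc t))
  placeB {b} {t} ρb≡t =
    count-cong (λ a → other-placed ρb≡t a λ ()) ,
    count-update b (unplaced⁺ (≤-reflexive (sym ρb≡t))) (λ h → 1+n≰n (subst (suc t ≤_) ρb≡t (unplaced⁻ h)))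
                 (λ k k≢b → other-unplaced ρb≡t k (k≢b ∘ inj₂-injective))

  unplacedB-end : ∀ {t} → n + 3 ≤ t → unplacedB t ≡ 0
  unplacedB-end N≤t = count-none λ k h → <⇒≱ (toℕ<n (Bijection.to σ (inj₂ k))) (≤-trans N≤t (unplaced⁻ h))

  placed-start : placed 0 ≡ 0
  placed-start = count-none {n} {λ a → ρ (inj₁ a) <ᵇ 0} λ a ()

  payment : ℕ → ℕ
  payment t = unplacedB t * admissibleAbove (placed t)

  φ : ℕ → ℕ
  φ t = potential (unplacedB t) (placed t)

  descent : ∀ t → φ t ≤ payment t + φ (suc t)
  descent t with t <? n + 3
  ... | no t≮N rewrite unplacedB-end (≮⇒≥ t≮N) = z≤n
  ... | yes t<N with ρ-onto t<N
  ...   | inj₁ a , ρa≡t rewrite proj₁ (placeA ρa≡t) | proj₂ (placeA ρa≡t) =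
    potential-placeA (placed t) (count≤n (λ k → unplaced t (inj₂ k)))
  ...   | inj₂ b , ρb≡t rewrite proj₁ (placeB ρb≡t) | proj₂ (placeB ρb≡t) =
    potential-placeB (unplacedB (suc t)) (placed t)

  strict-descent : ∀ {a b b₀} → (∀ k → ρ (inj₂ b₀) ≤ ρ (inj₂ k)) → ρ (inj₂ b) < ρ (inj₁ a) →
                   φ (ρ (inj₂ b₀)) < payment (ρ (inj₂ b₀)) + φ (suc (ρ (inj₂ b₀)))
  strict-descent {a} {b} {b₀} b₀-first b<a = begin-strict
    potential (unplacedB s) (placed s)
      ≡⟨ cong (λ c → potential c (placed s)) B≡3 ⟩
    potential 3 (placed s)
      <⟨ potential-placeB-< 1 placed<n ⟩
    3 * admissibleAbove (placed s) + potential 2 (placed s)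
      ≡⟨ sym (cong₂ (λ c d → c * admissibleAbove (placed s) + potential d (placed s)) B≡3 B-suc≡2) ⟩
    payment s + potential (unplacedB (suc s)) (placed s)
      ≡⟨ cong (λ j → payment s + potential (unplacedB (suc s)) j) (sym (proj₁ (placeB {b₀} refl))) ⟩
    payment s + φ (suc s) ∎
    where
    open ≤-Reasoning
    s = ρ (inj₂ b₀)
    B≡3 : unplacedB s ≡ 3
    B≡3 = count-all λ k → unplaced⁺ {s} {inj₂ k} (b₀-first k)
    B-suc≡2 : unplacedB (suc s) ≡ 2
    B-suc≡2 = suc-injective (trans (sym (proj₂ (placeB {b₀} refl))) B≡3)
    placed<n : placed s < n
    placed<n = count<n a λ h → <⇒≱ (<ᵇ⇒< (ρ (inj₁ a)) s h) (≤-trans (b₀-first b) (<⇒≤ b<a))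

  cost-σ : cost G σ ≡ sumFrom 0 (n + 3) payment
  cost-σ = trans (cost-layers G) (sumFrom-cong 0 (n + 3) λ t → cong (unplacedB t *_) (admissible-unplaced t))

  cost-τ : cost G τ ≡ 3 * tailSum 0
  cost-τ = begin
    cost G τ
      ≡⟨ Layers.cost-layers τ G ⟩
    sumFrom 0 (n + 3) (λ t → unplacedBτ t * admissibleIn G (λ a → unplacedτ t (inj₁ a)))
      ≡⟨ sumFrom-cong 0 (n + 3) payment-τ ⟩
    sumFrom 0 (n + 3) (λ t → 3 * admissibleAbove t)
      ≡⟨ sumFrom-*ˡ 0 (n + 3) 3 admissibleAbove ⟩
    3 * sumFrom 0 (n + 3) admissibleAbove
      ≡⟨ cong (3 *_) (sumFrom-admissibleAbove 0 (n + 3) (m≤m+n n 3)) ⟩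
    3 * tailSum 0 ∎
    where
    open ≡-Reasoning
    open Layers τ using () renaming (unplaced to unplacedτ; unplacedB to unplacedBτ)
    admissible-unplacedτ : ∀ t → admissibleIn G (λ a → unplacedτ t (inj₁ a)) ≡ admissibleAbove t
    admissible-unplacedτ t = ≤-antisym
      (admissibleIn-mono G λ a h → ≤⇒≤ᵇ (subst (t ≤_) (toℕ-τ-A a) (s≤s⁻¹ (<ᵇ⇒< t _ h))))
      (admissibleIn-mono G λ a h → <⇒<ᵇ (s≤s (subst (t ≤_) (sym (toℕ-τ-A a)) (≤ᵇ⇒≤ t (rank a) h))))
    payment-τ : ∀ t → unplacedBτ t * admissibleIn G (λ a → unplacedτ t (inj₁ a)) ≡ 3 * admissibleAbove t
    payment-τ t with t <? n
    ... | yes t<n = cong₂ _*_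
      (count-all λ k → <⇒<ᵇ (s≤s (subst (t ≤_) (sym (toℕ-τ-B k)) (≤-trans (<⇒≤ t<n) (m≤m+n n (toℕ k))))))
      (admissible-unplacedτ t)
    ... | no t≮n rewrite admissible-unplacedτ t | admissibleAbove-vanishes (≮⇒≥ t≮n) = *-zeroʳ (unplacedBτ t)

  cost-τ<cost-σ : ∀ {a b} → ρ (inj₂ b) < ρ (inj₁ a) → cost G τ < cost G σ
  cost-τ<cost-σ b<a = begin-strict
    cost G τ                               ≡⟨ cost-τ ⟩
    3 * tailSum 0                          ≡⟨ sym potential-start ⟩
    potential 3 0                          ≡⟨ cong (potential 3) (sym placed-start) ⟩
    φ 0                                    <⟨ telescope-< descent (strict-descent firstB-first b<a) 0 (n + 3)
                                                          z≤n (toℕ<n (Bijection.to σ (inj₂ firstB))) ⟩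
    sumFrom 0 (n + 3) payment + φ (n + 3)  ≡⟨ cong (λ c → sumFrom 0 (n + 3) payment + potential c (placed (n + 3)))
                                                   (unplacedB-end ≤-refl) ⟩
    sumFrom 0 (n + 3) payment + 0          ≡⟨ +-identityʳ _ ⟩
    sumFrom 0 (n + 3) payment              ≡⟨ sym cost-σ ⟩
    cost G σ                               ∎
    where
    open ≤-Reasoning
    firstB = argmin (λ k → ρ (inj₂ k)) zero (allFin 3)
    firstB-first : ∀ k → ρ (inj₂ firstB) ≤ ρ (inj₂ k)
    firstB-first k = All.lookup (f[argmin]≤f[xs] {f = λ k → ρ (inj₂ k)} zero (allFin 3)) (∈-allFin k)

lemma12 : (n : ℕ) (G : SimpleGraph n) (σ : Ordering n) →
          IsMinSumSetCover G σ →
          (a : Fin n) (b : Fin 3) → pos σ (inj₁ a) < pos σ (inj₂ b)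
lemma12 n G σ isMin a b = ≰⇒> λ b≤a → <⇒≱ (cost-τ<cost-σ (b-before-a b≤a)) (isMin τ)
  where
  open Rearrangement G σ
  b-before-a : pos σ (inj₂ b) ≤ pos σ (inj₁ a) → ρ (inj₂ b) < ρ (inj₁ a)
  b-before-a b≤a = ≤∧≢⇒< (s≤s⁻¹ b≤a) λ ρ≡ → case ρ-injective ρ≡ of λ ()
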